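{- Let $G$ be a finite group. If the S-ring $V(G,A_e)$ is a CI-S-ring for every $A \in \mathrm{Sup}^{\min}(G_R)$, then $G$ is a DCI-group.
   Context: For a finite group $G$, $\mathbb{Z}G$ is its integral group ring and for $X\subseteq G$, $\underline{X}=\sum_{x\in X}x$. An S-ring over $G$ is a subring $\mathcal{A}\subseteq \mathbb{Z}G$ for which there is a partition $\mathcal{S}(\mathcal{A})$ of $G$ (the basic sets) with $\{e\}\in\mathcal{S}(\mathcal{A})$, $X^{ -1}\in\mathcal{S}(\mathcal{A})$ whenever $X\in \mathcal{S}(\mathcal{A})$, and $\mathcal{A}=\mathrm{Span}_{\mathbb{Z}}\{\underline{X}: X\in\mathcal{S}(\mathcal{A})\}$. $G_R$ is the right regular representation of $G$ ($x\mapsto xg$). $\mathrm{Sup}(G_R)$ is the set of permutation groups on $G$ containing $G_R$; for $A\in \mathrm{Sup}(G_R)$, $V(G,A_e)$ is the S-ring whose basic sets are the orbits of the stabiliser $A_e$ of $e$. For $A\le B$ in $\mathrm{Sup}(G_R)$ write $A\preceq_G B$ if for every $\varphi\in\mathrm{Sym}(G)$ with $(G_R)^\varphi\le B$ there is $\psi\in B$ with $(G_R)^{\varphi\psi}\le A$; this is a partial order and $\mathrm{Sup}^{\min}(G_R)$ is its set of minimal elements. Cayley digraph $\mathrm{Cay}(G,X)$: vertices $G$, arcs $g\to xg$, $x\in X$. For S-rings $\mathcal{A}$ over $G$ and $\mathcal{B}$ over $H$, a bijection $\varphi:G\to H$ is an isomorphism if they have the same rank $r$ and the basic sets can be ordered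 $X_1,\dots,X_r$ and $Y_1,\dots,Y_r$ so that $\varphi$ is an isomorphism $\mathrm{Cay}(G,X_i)\to \mathrm{Cay}(H,Y_i)$ for all $i$. $\mathrm{Iso}(\mathcal{A})$ is the set of all isomorphisms from $\mathcal{A}$ to S-rings over $G$; $\mathrm{Aut}(\mathcal{A})=\bigcap_{X\in\mathcal{S}(\mathcal{A})}\mathrm{Aut}(\mathrm{Cay}(G,X))$. $\mathcal{A}$ is a CI-S-ring if $\mathrm{Aut}(\mathcal{A})\mathrm{Aut}(G)=\mathrm{Iso}(\mathcal{A})$. A DCI-group is a group $G$ such that for all $S,T\subseteq G\setminus\{e\}$, $\mathrm{Cay}(G,S)\cong\mathrm{Cay}(G,T)$ implies $T=S^\alpha$ for some $\alpha\in\mathrm{Aut}(G)$. -}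

module Defs where

open import Data.Nat using (ℕ; zero; suc)
open import Data.Fin using (Fin; zero; suc; _≟_)
open import Data.Integer using (ℤ; _+_; _*_; -_; 0ℤ; 1ℤ)
open import Data.Bool using (Bool; true; false; if_then_else_)
open import Data.Product using (Σ; ∃; _×_; _,_; proj₁; proj₂)
open import Relation.Nullary using (¬_; Dec; yes; no)
open import Relation.Nullary.Decidable using (⌊_⌋)
open import Relation.Binary.PropositionalEquality
open import Function.Bundles using (_⇔_)
open import Algebra.Structures using (IsGroup)

record FinGroup : Set₁ where
  infixl 7 _∙_
  field
    Carrier  : Set
    _∙_      : Carrier → Carrier → Carrier
    ε        : Carrier
    _⁻¹      : Carrier → Carrier
    isGroup  : IsGroup (_≡_ {A = Carrier}) _∙_ ε _⁻¹
    size     : ℕ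
    enum     : Fin size → Carrier
    index    : Carrier → Fin size
    enum-index : ∀ x → enum (index x) ≡ x
    index-enum : ∀ k → index (enum k) ≡ k

-- Permutations of a set (elements of Sym(X)); maps act on the right,
-- and φ ⨾ ψ means "first φ, then ψ" (i.e. the product φψ).

record Perm (X : Set) : Set where
  field
    to        : X → X
    from      : X → X
    to-from   : ∀ x → to (from x) ≡ x
    from-to   : ∀ x → from (to x) ≡ x
open Perm public

idP : ∀ {X} → Perm X
idP = record { to = λ x → x ; from = λ x → x
             ; to-from = λ _ → refl ; from-to = λ _ → refl }

infixl 5 _⨾_
_⨾_ : ∀ {X} → Perm X → Perm X → Perm X
φ ⨾ ψ = record
  { to = λ x → to ψ (to φ x)
  ; from = λ x → from φ (from ψ x)
  ; to-from = λ x → trans (cong (to ψ) (to-from φ (from ψ x))) (to-from ψ x)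
  ; from-to = λ x → trans (cong (from φ) (from-to ψ (to φ x))) (from-to φ x) }

invP : ∀ {X} → Perm X → Perm X
invP φ = record { to = from φ ; from = to φ
                ; to-from = from-to φ ; from-to = to-from φ }

_≈ₚ_ : ∀ {X} → Perm X → Perm X → Set
φ ≈ₚ ψ = ∀ x → to φ x ≡ to ψ x

conj : ∀ {X} → Perm X → Perm X → Perm X
conj φ π = invP φ ⨾ π ⨾ φ

sumFin : ∀ {n} → (Fin n → ℤ) → ℤ
sumFin {zero}  f = 0ℤ
sumFin {suc n} f = f zero + sumFin (λ i → f (suc i))

module _ (G : FinGroup) where
  open FinGroup G
  open IsGroup isGroup using (assoc; inverseˡ; inverseʳ; identityʳ)

  _≟G_ : (x y : Carrier) → Dec (x ≡ y)
  x ≟G y with index x ≟ index y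
  ... | yes p = yes (trans (sym (enum-index x)) (trans (cong enum p) (enum-index y)))
  ... | no ¬p = no (λ q → ¬p (cong index q))

  ρ : Carrier → Perm Carrier
  ρ g = record
    { to = λ x → x ∙ g
    ; from = λ x → x ∙ g ⁻¹
    ; to-from = λ x → trans (assoc x (g ⁻¹) g)
                        (trans (cong (x ∙_) (inverseˡ g)) (identityʳ x))
    ; from-to = λ x → trans (assoc x g (g ⁻¹))
                        (trans (cong (x ∙_) (inverseʳ g)) (identityʳ x)) }

  PermSet : Set₁
  PermSet = Perm Carrier → Set

  record IsPermGroup (A : PermSet) : Set where
    field
      resp≈ : ∀ {φ ψ} → φ ≈ₚ ψ → A φ → A ψ
      id∈   : A idP
      ⨾∈    : ∀ {φ ψ} → A φ → A ψ → A (φ ⨾ ψ)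
      inv∈  : ∀ {φ} → A φ → A (invP φ)

  _⊆ₚ_ : PermSet → PermSet → Set
  A ⊆ₚ B = ∀ φ → A φ → B φ

  InSup : PermSet → Set
  InSup A = IsPermGroup A × (∀ g → A (ρ g))

  GR^_≤_ : Perm Carrier → PermSet → Set
  GR^ φ ≤ B = ∀ g → B (conj φ (ρ g))

  _⪯_ : PermSet → PermSet → Set
  A ⪯ B = A ⊆ₚ B × (∀ φ → GR^ φ ≤ B → Σ (Perm Carrier) λ ψ → B ψ × GR^ (φ ⨾ ψ) ≤ A)

  SupMin : PermSet → Set₁
  SupMin A = InSup A × (∀ B → InSup B → B ⪯ A → A ⊆ₚ B)

  Arc : (Carrier → Set) → Carrier → Carrier → Set
  Arc X u v = ∃ λ x → X x × v ≡ x ∙ u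

  IsCayIso : Perm Carrier → (Carrier → Set) → (Carrier → Set) → Set
  IsCayIso φ X Y = ∀ u v → Arc X u v ⇔ Arc Y (to φ u) (to φ v)

  IsGroupAut : Perm Carrier → Set
  IsGroupAut α = ∀ x y → to α (x ∙ y) ≡ to α x ∙ to α y

  ZG : Set
  ZG = Carrier → ℤ

  oneZG : ZG
  oneZG z = if ⌊ z ≟G ε ⌋ then 1ℤ else 0ℤ

  _*ZG_ : ZG → ZG → ZG
  (f *ZG g) z = sumFin (λ k → f (enum k) * g (enum k ⁻¹ ∙ z))

  record Partition (r : ℕ) : Set where
    field
      colour : Carrier → Fin r
      nonempty : ∀ i → ∃ λ x → colour x ≡ i

  module _ {r : ℕ} where
    open Partition

    Basic : Partition r → Fin r → Carrier → Set
    Basic P i x = colour P x ≡ i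

    under : Partition r → Fin r → ZG
    under P i z = if ⌊ colour P z ≟ i ⌋ then 1ℤ else 0ℤ

    InSpan : Partition r → ZG → Set
    InSpan P f = ∃ λ (c : Fin r → ℤ) → ∀ z → f z ≡ sumFin (λ i → c i * under P i z)

    SpanIsSubring : Partition r → Set
    SpanIsSubring P =
        InSpan P oneZG
      × InSpan P (λ _ → 0ℤ)
      × (∀ f g → InSpan P f → InSpan P g → InSpan P (λ z → f z + g z))
      × (∀ f → InSpan P f → InSpan P (λ z → - f z))
      × (∀ f g → InSpan P f → InSpan P g → InSpan P (f *ZG g))

    IsSRing : Partition r → Set
    IsSRing P =
        (∃ λ i → ∀ x → Basic P i x ⇔ x ≡ ε)
      × (∀ i → ∃ λ j → ∀ y → Basic P j y ⇔ Basic P i (y ⁻¹))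
      × SpanIsSubring P

    -- φ is an isomorphism from the S-ring of P to the S-ring of Q
    -- (same rank r; σ orders the basic sets correspondingly)
    IsSRingIso : Partition r → Partition r → Perm Carrier → Set
    IsSRingIso P Q φ = ∃ λ (σ : Perm (Fin r)) →
      ∀ i → IsCayIso φ (Basic P i) (Basic Q (to σ i))

    InIso : Partition r → Perm Carrier → Set
    InIso P φ = Σ (Partition r) λ Q → IsSRing Q × IsSRingIso P Q φ

    InAutS : Partition r → Perm Carrier → Set
    InAutS P φ = ∀ i → IsCayIso φ (Basic P i) (Basic P i)

    IsCISRing : Partition r → Set
    IsCISRing P = ∀ φ → InIso P φ ⇔
      (∃ λ α → ∃ λ β → InAutS P α × IsGroupAut β × φ ≈ₚ (α ⨾ β))

    -- the basic sets of P are exactly the orbits of the stabiliser A_e,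
    -- i.e. P presents the S-ring V(G, A_e)
    IsOrbitPartition : PermSet → Partition r → Set
    IsOrbitPartition A P = ∀ x y →
      colour P x ≡ colour P y ⇔ (∃ λ a → A a × to a ε ≡ ε × to a x ≡ y)

  IsDCI : Set
  IsDCI = ∀ (S T : Carrier → Bool) → S ε ≡ false → T ε ≡ false →
    (∃ λ φ → IsCayIso φ (λ x → S x ≡ true) (λ x → T x ≡ true)) →
    ∃ λ α → IsGroupAut α × (∀ x → T (to α x) ≡ S x)

module Submission where

-- Let φ : Cay(G,S) → Cay(G,T) be an isomorphism and B₀ = Aut(Cay(G,S)). Since Sym(G) is
-- finite there is A ∈ Sup^min(G_R) with A ⪯ B₀: among the groups generated by G_R and a
-- sublist of Sym(G) that are ⪯ B₀ take one of least order; if B ⪯ A, the conjugates of G_R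
-- witnessing this generate such a group inside B, so minimality forces A ≤ B.
-- As (G_R)^{φ⁻¹} ≤ B₀, correcting φ by an element of B₀ and a right translation gives an
-- isomorphism φ′ : Cay(G,S) → Cay(G,T) fixing e with (G_R)^{φ′⁻¹} ≤ A. Then φ′ maps the orbit
-- S-ring V(G,A_e) onto the orbit S-ring of φ′A φ′⁻¹, so by the CI hypothesis φ′ = αβ with
-- α ∈ Aut(V(G,A_e)) and β ∈ Aut(G). Because A ≤ B₀, S is a union of basic sets of V(G,A_e);
-- hence α preserves S and T = S^β.

open import Defs
open import Data.Nat as ℕ using (ℕ; zero; suc; _≤_; _<_; _≤′_; ≤′-refl; ≤′-step; z≤n; s≤s)
import Data.Nat.Properties as ℕ
open import Data.Fin as Fin using (Fin; zero; suc)
import Data.Fin.Properties as Fin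
open import Data.Integer as ℤ using (ℤ; _+_; _*_; -_; 0ℤ; 1ℤ)
import Data.Integer.Properties as ℤ
open import Data.Bool using (Bool; true; false; if_then_else_)
import Data.Bool.Properties as Bool
open import Data.Product using (Σ; ∃; ∃-syntax; _×_; _,_; proj₁; proj₂)
open import Data.Sum as Sum using (_⊎_; inj₁; inj₂)
open import Data.Empty using (⊥-elim)
open import Data.List using (List; []; _∷_; [_]; _++_; map; length; filter; allFin; cartesianProductWith)
import Data.List.Properties
open import Data.List.Relation.Unary.Any as Any using (Any; here; there)
import Data.List.Relation.Unary.Any.Properties as Any
import Data.List.Relation.Unary.All as All
open import Data.List.Membership.Propositional using (_∈_; find; lose)
open import Data.List.Membership.Propositional.Properties
  using (∈-allFin; ∈-filter⁺; ∈-filter⁻; ∈-map⁺; ∈-map⁻; ∈-++⁺ˡ; ∈-++⁺ʳ; ∈-++⁻)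
open import Data.List.Extrema.Nat using (argmin; argmin-sel; f[argmin]≤f[xs])
import Data.Vec.Functional as Vector
open import Function using (_∘_; _⇔_; mk⇔; Equivalence; _↔_; mk↔ₛ′; Inverse)
import Function.Properties.Equivalence as ⇔
open import Level using (0ℓ)
open import Relation.Nullary using (¬_; Dec; yes; no; does)
open import Relation.Nullary.Decidable as Dec using (_×-dec_; _⊎-dec_; _→-dec_; ⌊_⌋; does-⇔)
open import Relation.Unary using (Decidable; _⊆_)
open import Relation.Binary.PropositionalEquality hiding ([_])
open import Relation.Binary.Structures using (IsEquivalence)
import Relation.Binary.Construct.On as On
import Relation.Binary.Reasoning.Setoid as SetoidReasoning
open import Algebra.Structures using (IsGroup)
open import Algebra.Bundles using (Group)
open import Algebra.Properties.CommutativeMonoid.Sum ℤ.+-0-commutativeMonoid using (sum; sum-permute)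

private variable T : Set

-- Finite enumerations, counting and sums

allFunctions : ∀ n m → List (Fin n → Fin m)
allFunctions zero    m = [ (λ ()) ]
allFunctions (suc n) m = cartesianProductWith Vector._∷_ (allFin m) (allFunctions n m)

allFunctions-complete : ∀ {n m} (f : Fin n → Fin m) → Any (f ≗_) (allFunctions n m)
allFunctions-complete {zero}  f = here (λ ())
allFunctions-complete {suc n} f =
  Any.cartesianProductWith⁺ Vector._∷_ cons (∈-allFin (f zero)) (allFunctions-complete (f ∘ suc))
  where
  cons : ∀ {x g} → f zero ≡ x → f ∘ suc ≗ g → f ≗ (x Vector.∷ g)
  cons fz fs zero    = fz
  cons fz fs (suc i) = fs i

sublists : List T → List (List T)
sublists []       = [ [] ]
sublists (x ∷ xs) = map (x ∷_) (sublists xs) ++ sublists xs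

filter∈sublists : ∀ {P : T → Set} (P? : Decidable P) xs → filter P? xs ∈ sublists xs
filter∈sublists P? []       = here refl
filter∈sublists P? (x ∷ xs) with does (P? x)
... | true  = Any.++⁺ˡ (Any.map⁺ (Any.map (cong (x ∷_)) (filter∈sublists P? xs)))
... | false = Any.++⁺ʳ _ (filter∈sublists P? xs)

argmin-satisfying : (f : T → ℕ) {P : T → Set} (P? : Decidable P) {x₀ : T} → P x₀ → ∀ xs →
  ∃[ m ] P m × (∀ y → y ∈ xs → P y → f m ≤ f y)
argmin-satisfying f {P} P? {x₀} Px₀ xs = m , Pm , m-least
  where
  m = argmin f x₀ (filter P? xs)
  Pm : P m
  Pm = Sum.[ (λ m≡x₀ → subst P (sym m≡x₀) Px₀) , (λ m∈ → proj₂ (∈-filter⁻ P? {xs = xs} m∈)) ]′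
           (argmin-sel f x₀ (filter P? xs))
  m-least : ∀ y → y ∈ xs → P y → f m ≤ f y
  m-least y y∈xs Py = All.lookup (f[argmin]≤f[xs] x₀ (filter P? xs)) (∈-filter⁺ P? y∈xs Py)

≡⇒⇔ : (P : T → Set) {x y : T} → x ≡ y → P x ⇔ P y
≡⇒⇔ P refl = ⇔.refl

≡true-injective : ∀ {a b : Bool} → (a ≡ true ⇔ b ≡ true) → a ≡ b
≡true-injective {false} {false} _ = refl
≡true-injective {false} {true}  e = Equivalence.from e refl
≡true-injective {true}  {false} e = sym (Equivalence.to e refl)
≡true-injective {true}  {true}  _ = refl

module _ {P Q : T → Set} (P? : Decidable P) (Q? : Decidable Q) (P⊆Q : P ⊆ Q) where

  length-filter-mono : ∀ xs → length (filter P? xs) ≤ length (filter Q? xs)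
  length-filter-mono []       = z≤n
  length-filter-mono (x ∷ xs) with P? x | Q? x
  ... | yes _  | yes _  = s≤s (length-filter-mono xs)
  ... | yes px | no ¬qx = ⊥-elim (¬qx (P⊆Q px))
  ... | no _   | yes _  = ℕ.m≤n⇒m≤1+n (length-filter-mono xs)
  ... | no _   | no _   = length-filter-mono xs

  length-filter-< : ∀ xs → Any (λ x → Q x × ¬ P x) xs → length (filter P? xs) < length (filter Q? xs)
  length-filter-< (x ∷ xs) (here (qx , ¬px)) with P? x | Q? x
  ... | yes px | _      = ⊥-elim (¬px px)
  ... | no _   | yes _  = s≤s (length-filter-mono xs)
  ... | no _   | no ¬qx = ⊥-elim (¬qx qx)
  length-filter-< (x ∷ xs) (there w) with P? x | Q? x
  ... | yes _  | yes _  = s≤s (length-filter-< xs w)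
  ... | yes px | no ¬qx = ⊥-elim (¬qx (P⊆Q px))
  ... | no _   | yes _  = ℕ.m≤n⇒m≤1+n (length-filter-< xs w)
  ... | no _   | no _   = length-filter-< xs w

sumFin-cong : ∀ {n} {f g : Fin n → ℤ} → f ≗ g → sumFin f ≡ sumFin g
sumFin-cong {zero}  f≗g = refl
sumFin-cong {suc n} f≗g = cong₂ _+_ (f≗g zero) (sumFin-cong (f≗g ∘ suc))

sumFin≡sum : ∀ {n} (f : Fin n → ℤ) → sumFin f ≡ sum f
sumFin≡sum {zero}  f = refl
sumFin≡sum {suc n} f = cong (f zero +_) (sumFin≡sum (f ∘ suc))

sumFin-permute : ∀ {n} (f : Fin n → ℤ) (π : Fin n ↔ Fin n) → sumFin f ≡ sumFin (f ∘ Inverse.to π)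
sumFin-permute f π = trans (sumFin≡sum f) (trans (sum-permute f π) (sym (sumFin≡sum (f ∘ Inverse.to π))))

indicator : ∀ {P : Set} → Dec P → ℤ
indicator P? = if ⌊ P? ⌋ then 1ℤ else 0ℤ

sumFin-indicator : ∀ {r} (c : Fin r → ℤ) k → sumFin (λ i → c i * indicator (k Fin.≟ i)) ≡ c k
sumFin-indicator {suc r} c zero = begin
  c zero * 1ℤ + sumFin (λ i → c (suc i) * 0ℤ) ≡⟨ cong₂ _+_ (ℤ.*-identityʳ (c zero)) (sumFin-zero r (ℤ.*-zeroʳ ∘ c ∘ suc)) ⟩
  c zero + 0ℤ                                 ≡⟨ ℤ.+-identityʳ (c zero) ⟩
  c zero                                      ∎
  where
  open ≡-Reasoning
  sumFin-zero : ∀ n {f : Fin n → ℤ} → f ≗ (λ _ → 0ℤ) → sumFin f ≡ 0ℤ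
  sumFin-zero zero    _   = refl
  sumFin-zero (suc n) f≗0 = cong₂ _+_ (f≗0 zero) (sumFin-zero n (f≗0 ∘ suc))
sumFin-indicator {suc r} c (suc k) = begin
  c zero * 0ℤ + sumFin (λ i → c (suc i) * indicator (suc k Fin.≟ suc i))
    ≡⟨ cong₂ _+_ (ℤ.*-zeroʳ (c zero))
                 (sumFin-cong (λ i → cong (λ b → c (suc i) * (if b then 1ℤ else 0ℤ))
                                          (Dec.⌊⌋-map′ (cong suc) Fin.suc-injective (k Fin.≟ i)))) ⟩
  0ℤ + sumFin (λ i → c (suc i) * indicator (k Fin.≟ i))
    ≡⟨ ℤ.+-identityˡ _ ⟩
  sumFin (λ i → c (suc i) * indicator (k Fin.≟ i))
    ≡⟨ sumFin-indicator (c ∘ suc) k ⟩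
  c (suc k) ∎
  where open ≡-Reasoning

record Quotient {n : ℕ} (R : Fin n → Fin n → Set) : Set where
  field
    rank             : ℕ
    class            : Fin n → Fin rank
    class-≡⇔         : ∀ i j → class i ≡ class j ⇔ R i j
    class-surjective : ∀ k → ∃[ i ] class i ≡ k

private
  module Extend {n} {R : Fin (suc n) → Fin (suc n) → Set} (isEq : IsEquivalence R)
                (Q : Quotient (λ i j → R (suc i) (suc j))) where
    open IsEquivalence isEq renaming (refl to R-refl; sym to R-sym; trans to R-trans)
    module Q = Quotient Q

    joining : ∀ j₀ → R zero (suc j₀) → Quotient R
    joining j₀ R0j₀ = record
      { rank             = Q.rank
      ; class            = class
      ; class-≡⇔         = class-≡⇔
      ; class-surjective = λ k → let i , e = Q.class-surjective k in suc i , e }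
      where
      class : Fin (suc n) → Fin Q.rank
      class zero    = Q.class j₀
      class (suc i) = Q.class i
      class-≡⇔ : ∀ i j → class i ≡ class j ⇔ R i j
      class-≡⇔ zero    zero    = mk⇔ (λ _ → R-refl) (λ _ → refl)
      class-≡⇔ zero    (suc j) = mk⇔ (R-trans R0j₀ ∘ Equivalence.to (Q.class-≡⇔ j₀ j))
                                     (Equivalence.from (Q.class-≡⇔ j₀ j) ∘ R-trans (R-sym R0j₀))
      class-≡⇔ (suc i) zero    = ⇔.trans (mk⇔ sym sym) (⇔.trans (class-≡⇔ zero (suc i)) (mk⇔ R-sym R-sym))
      class-≡⇔ (suc i) (suc j) = Q.class-≡⇔ i j

    separate : ¬ (∃[ j ] R zero (suc j)) → Quotient R
    separate ¬R0 = record
      { rank             = suc Q.rank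
      ; class            = class
      ; class-≡⇔         = class-≡⇔
      ; class-surjective = λ { zero → zero , refl ; (suc k) → let i , e = Q.class-surjective k in suc i , cong suc e } }
      where
      class : Fin (suc n) → Fin (suc Q.rank)
      class zero    = zero
      class (suc i) = suc (Q.class i)
      class-≡⇔ : ∀ i j → class i ≡ class j ⇔ R i j
      class-≡⇔ zero    zero    = mk⇔ (λ _ → R-refl) (λ _ → refl)
      class-≡⇔ zero    (suc j) = mk⇔ (λ ()) (λ r → ⊥-elim (¬R0 (j , r)))
      class-≡⇔ (suc i) zero    = mk⇔ (λ ()) (λ r → ⊥-elim (¬R0 (i , R-sym r)))
      class-≡⇔ (suc i) (suc j) = ⇔.trans (mk⇔ Fin.suc-injective (cong suc)) (Q.class-≡⇔ i j)

quotient : ∀ {n} {R : Fin n → Fin n → Set} → IsEquivalence R → (∀ i j → Dec (R i j)) → Quotient R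
quotient {zero}  _    _  = record { rank = 0 ; class = λ () ; class-≡⇔ = λ () ; class-surjective = λ () }
quotient {suc n} {R} isEq R? = extend (Fin.any? (λ j → R? zero (suc j)))
  where
  restriction : Quotient (λ i j → R (suc i) (suc j))
  restriction = quotient (On.isEquivalence suc isEq) (λ i j → R? (suc i) (suc j))
  extend : Dec (∃[ j ] R zero (suc j)) → Quotient R
  extend (yes (j₀ , R0j₀)) = Extend.joining isEq restriction j₀ R0j₀
  extend (no ¬R0)          = Extend.separate isEq restriction ¬R0

-- Permutations of a finite set

module FinitePermutations {X : Set} {n : ℕ} (enum : Fin n → X) (index : X → Fin n)
  (enum-index : ∀ x → enum (index x) ≡ x) (index-enum : ∀ k → index (enum k) ≡ k) where

  ∀? : {P : X → Set} → Decidable P → Dec (∀ x → P x)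
  ∀? {P} P? = Dec.map′ (λ h x → subst P (enum-index x) (h (index x))) (λ h → h ∘ enum)
                       (Fin.all? (P? ∘ enum))

  ∃? : {P : X → Set} → Decidable P → Dec (∃ P)
  ∃? {P} P? = Dec.map′ (λ (i , p) → enum i , p) (λ (x , p) → index x , subst P (sym (enum-index x)) p)
                       (Fin.any? (P? ∘ enum))

  _≟_ : (x y : X) → Dec (x ≡ y)
  x ≟ y = Dec.map′ (λ e → trans (sym (enum-index x)) (trans (cong enum e) (enum-index y)))
                   (cong index) (index x Fin.≟ index y)

  infix 4 _≃_
  record _≃_ (p q : Perm X) : Set where
    constructor mk≃
    field pointwise : p ≈ₚ q
  open _≃_ public

  ≃-refl : ∀ {p} → p ≃ p
  ≃-refl = mk≃ (λ _ → refl)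

  ≃-sym : ∀ {p q} → p ≃ q → q ≃ p
  ≃-sym (mk≃ e) = mk≃ (λ x → sym (e x))

  ≃-trans : ∀ {p q r} → p ≃ q → q ≃ r → p ≃ r
  ≃-trans (mk≃ e) (mk≃ f) = mk≃ (λ x → trans (e x) (f x))

  ⨾-cong : ∀ {p p′ q q′} → p ≃ p′ → q ≃ q′ → p ⨾ q ≃ p′ ⨾ q′
  ⨾-cong {q = q} (mk≃ e) (mk≃ f) = mk≃ (λ x → trans (cong (to q) (e x)) (f _))

  ⨾-assoc : ∀ p q r → (p ⨾ q) ⨾ r ≃ p ⨾ (q ⨾ r)
  ⨾-assoc p q r = mk≃ (λ _ → refl)

  invP-cong : ∀ {p q} → p ≃ q → invP p ≃ invP q
  invP-cong {p} {q} (mk≃ e) =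
    mk≃ (λ x → trans (sym (from-to q (from p x))) (cong (from q) (trans (sym (e _)) (to-from p x))))

  conj-cong : ∀ {φ φ′ π π′} → φ ≃ φ′ → π ≃ π′ → conj φ π ≃ conj φ′ π′
  conj-cong e f = ⨾-cong (⨾-cong (invP-cong e) f) e

  _≃?_ : (p q : Perm X) → Dec (p ≃ q)
  p ≃? q = Dec.map′ mk≃ pointwise (∀? (λ x → to p x ≟ to q x))

  private
    Code : Set
    Code = (Fin n → Fin n) × (Fin n → Fin n)

    Inverses : Code → Set
    Inverses (f , g) = (∀ i → f (g i) ≡ i) × (∀ i → g (f i) ≡ i)

    inverses? : ∀ c → Dec (Inverses c)
    inverses? (f , g) = Fin.all? (λ i → f (g i) Fin.≟ i) ×-dec Fin.all? (λ i → g (f i) Fin.≟ i)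

    decode : (c : Code) → Inverses c → Perm X
    decode (f , g) (fg , gf) = record
      { to      = enum ∘ f ∘ index
      ; from    = enum ∘ g ∘ index
      ; to-from = λ x → trans (cong (enum ∘ f) (index-enum _)) (trans (cong enum (fg _)) (enum-index x))
      ; from-to = λ x → trans (cong (enum ∘ g) (index-enum _)) (trans (cong enum (gf _)) (enum-index x)) }

    -- Pairs that are not mutually inverse decode to the junk value idP.
    decode? : Code → Perm X
    decode? c with inverses? c
    ... | yes inv = decode c inv
    ... | no _    = idP

    Encodes : Perm X → Code → Set
    Encodes p (f , g) = (index ∘ to p ∘ enum ≗ f) × (index ∘ from p ∘ enum ≗ g)

    index-cancel : (p : Perm X) → ∀ i → index (to p (enum (index (from p (enum i))))) ≡ i
    index-cancel p i = trans (cong (index ∘ to p) (enum-index _)) (trans (cong index (to-from p _)) (index-enum i))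

    encodes-inverses : ∀ p c → Encodes p c → Inverses c
    encodes-inverses p (f , g) (ef , eg) =
      (λ i → trans (sym (ef _)) (trans (cong (index ∘ to p ∘ enum) (sym (eg i))) (index-cancel p i))) ,
      (λ i → trans (sym (eg _)) (trans (cong (index ∘ from p ∘ enum) (sym (ef i))) (index-cancel (invP p) i)))

    decode?-encodes : ∀ p c → Encodes p c → p ≃ decode? c
    decode?-encodes p c enc with inverses? c
    ... | yes _   = mk≃ (λ x → sym (trans (cong enum (sym (proj₁ enc (index x))))
                                         (trans (enum-index _) (cong (to p) (enum-index x)))))
    ... | no ¬inv = ⊥-elim (¬inv (encodes-inverses p c enc))

  sum-reindex : (F : X → ℤ) (σ : Perm X) → sumFin (F ∘ enum) ≡ sumFin (F ∘ to σ ∘ enum)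
  sum-reindex F σ = trans
    (sumFin-permute (F ∘ enum) (mk↔ₛ′ (index ∘ to σ ∘ enum) (index ∘ from σ ∘ enum) (index-cancel σ) (index-cancel (invP σ))))
    (sumFin-cong {g = F ∘ to σ ∘ enum} (λ i → cong F (enum-index (to σ (enum i)))))

  allPerms : List (Perm X)
  allPerms = map decode? (cartesianProductWith _,_ (allFunctions n n) (allFunctions n n))

  allPerms-complete : ∀ p → Any (p ≃_) allPerms
  allPerms-complete p = Any.map⁺ (Any.map (decode?-encodes p _)
    (Any.cartesianProductWith⁺ _,_ _,_ (allFunctions-complete (index ∘ to p ∘ enum))
                                        (allFunctions-complete (index ∘ from p ∘ enum))))

  Respects≃ : (Perm X → Set) → Set
  Respects≃ P = ∀ {p q} → p ≃ q → P p → P q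

  ∀-perm? : {P : Perm X → Set} → Respects≃ P → Decidable P → Dec (∀ p → P p)
  ∀-perm? resp P? = Dec.map′
    (λ all p → All.lookupWith (λ Pq p≃q → resp (≃-sym p≃q) Pq) all (allPerms-complete p))
    (λ h → All.tabulate (λ {p} _ → h p)) (All.all? P? allPerms)

  ∃-perm? : {P : Perm X → Set} → Respects≃ P → Decidable P → Dec (∃ P)
  ∃-perm? resp P? = Dec.map′ Any.satisfied
    (λ (p , Pp) → Any.map (λ p≃q → resp p≃q Pp) (allPerms-complete p)) (Any.any? P? allPerms)

  record DecidablePermSet (A : Perm X → Set) : Set where
    field
      respects : Respects≃ A
      decide   : Decidable A
  open DecidablePermSet public

  ∣_∣ : {A : Perm X → Set} → DecidablePermSet A → ℕ
  ∣ dA ∣ = length (filter (decide dA) allPerms)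

  module _ {A B : Perm X → Set} (dA : DecidablePermSet A) (dB : DecidablePermSet B) (A⊆B : A ⊆ B) where

    ⊆-by-∣∣ : ∣ dB ∣ ≤ ∣ dA ∣ → B ⊆ A
    ⊆-by-∣∣ ∣B∣≤∣A∣ {p} Bp with decide dA p
    ... | yes Ap = Ap
    ... | no ¬Ap = ⊥-elim (ℕ.<⇒≱ (length-filter-< (decide dA) (decide dB) A⊆B allPerms
                     (Any.map (λ p≃q → respects dB p≃q Bp , ¬Ap ∘ respects dA (≃-sym p≃q)) (allPerms-complete p)))
                     ∣B∣≤∣A∣)

  ∣∣≤∣perms∣ : {A : Perm X → Set} (dA : DecidablePermSet A) → ∣ dA ∣ ≤ length allPerms
  ∣∣≤∣perms∣ dA = Data.List.Properties.length-filter (decide dA) allPerms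

  module _ {W : ℕ → Perm X → Set} (dW : ∀ k → DecidablePermSet (W k)) (W-ascending : ∀ k → W k ⊆ W (suc k)) where

    private
      grows-or-stalls : ∀ m → m ≤ ∣ dW m ∣ ⊎ ∃[ k ] k < m × ∣ dW (suc k) ∣ ≤ ∣ dW k ∣
      grows-or-stalls zero = inj₁ z≤n
      grows-or-stalls (suc m) with grows-or-stalls m
      ... | inj₂ (k , k<m , stall) = inj₂ (k , ℕ.m≤n⇒m≤1+n k<m , stall)
      ... | inj₁ m≤∣Wm∣ with ∣ dW (suc m) ∣ ℕ.≤? ∣ dW m ∣
      ...   | yes stall = inj₂ (m , ℕ.n<1+n m , stall)
      ...   | no grow   = inj₁ (ℕ.≤-trans (s≤s m≤∣Wm∣) (ℕ.≰⇒> grow))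

    ascending-chain-stalls : ∃[ k ] k ≤ length allPerms × W (suc k) ⊆ W k
    ascending-chain-stalls with grows-or-stalls (suc (length allPerms))
    ... | inj₁ too-big = ⊥-elim (ℕ.<⇒≱ too-big (∣∣≤∣perms∣ (dW _)))
    ... | inj₂ (k , s≤s k≤N , stall) = k , k≤N , ⊆-by-∣∣ (dW k) (dW (suc k)) (W-ascending k) stall

module _ (G : FinGroup) where
  open FinGroup G
  open IsGroup isGroup using (assoc; identityˡ; identityʳ; inverseʳ)
  open FinitePermutations enum index enum-index index-enum

  private
    group : Group _ _
    group = record { isGroup = isGroup }

    Permutation : Set
    Permutation = Perm Carrier

    infix 4 _⪯ᴳ_
    _⪯ᴳ_ : PermSet G → PermSet G → Set
    _⪯ᴳ_ = _⪯_ G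

    GR^_≤ᴳ_ : Permutation → PermSet G → Set
    GR^_≤ᴳ_ = GR^_≤_ G

  open import Algebra.Properties.Group group
    using (ε⁻¹≈ε; ⁻¹-involutive; ⁻¹-anti-homo-∙; identityˡ-unique;
           //-rightDividesˡ; //-rightDividesʳ; \\-leftDividesˡ)

  -- Minimal overgroups of G_R

  module _ {B : PermSet G} (dB : DecidablePermSet B) where

    GR≤-respects : Respects≃ (λ φ → GR^ φ ≤ᴳ B)
    GR≤-respects φ≃φ′ GR≤B g = respects dB (conj-cong φ≃φ′ (≃-refl {ρ G g})) (GR≤B g)

    GR≤? : Decidable (λ φ → GR^ φ ≤ᴳ B)
    GR≤? φ = ∀? (λ g → decide dB (conj φ (ρ G g)))

  group-respects : ∀ {B} → IsPermGroup G B → Respects≃ B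
  group-respects B-group {p} {q} (mk≃ p≈q) = IsPermGroup.resp≈ B-group {p} {q} p≈q

  ⪯? : {A B : PermSet G} → DecidablePermSet A → DecidablePermSet B → Dec (A ⪯ᴳ B)
  ⪯? {A} {B} dA dB = ⊆? ×-dec ∀-perm? lift-respects (λ φ → GR≤? dB φ →-dec ∃-perm? (lifts-respects φ) (lifts? φ))
    where
    ⊆? : Dec (∀ p → A p → B p)
    ⊆? = ∀-perm? (λ p≃q A⇒B Aq → respects dB p≃q (A⇒B (respects dA (≃-sym p≃q) Aq)))
                 (λ p → decide dA p →-dec decide dB p)
    Lifts : Permutation → Permutation → Set
    Lifts φ ψ = B ψ × GR^ (φ ⨾ ψ) ≤ᴳ A
    lifts? : ∀ φ → Decidable (Lifts φ)
    lifts? φ ψ = decide dB ψ ×-dec GR≤? dA (φ ⨾ ψ)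
    lifts-respects : ∀ φ → Respects≃ (Lifts φ)
    lifts-respects φ ψ≃ψ′ (Bψ , GR≤A) = respects dB ψ≃ψ′ Bψ , GR≤-respects dA (⨾-cong (≃-refl {φ}) ψ≃ψ′) GR≤A
    lift-respects : Respects≃ (λ φ → GR^ φ ≤ᴳ B → ∃ (Lifts φ))
    lift-respects φ≃φ′ lift GR≤B =
      let (ψ , lifts) = lift (GR≤-respects dB (≃-sym φ≃φ′) GR≤B)
      in ψ , proj₁ lifts , GR≤-respects dA (⨾-cong φ≃φ′ (≃-refl {ψ})) (proj₂ lifts)

  ⪯-trans : {A B C : PermSet G} → DecidablePermSet A → IsPermGroup G C → A ⪯ᴳ B → B ⪯ᴳ C → A ⪯ᴳ C
  ⪯-trans dA C-group (A⊆B , liftAB) (B⊆C , liftBC) = (λ p → B⊆C p ∘ A⊆B p) , λ φ GR≤C →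
    let (ψ₁ , Cψ₁ , GR≤B) = liftBC φ GR≤C
        (ψ₂ , Bψ₂ , GR≤A) = liftAB (φ ⨾ ψ₁) GR≤B
    in ψ₁ ⨾ ψ₂ , IsPermGroup.⨾∈ C-group Cψ₁ (B⊆C ψ₂ Bψ₂) , GR≤-respects dA (⨾-assoc φ ψ₁ ψ₂) GR≤A

  module Generated (gens : List Permutation) where

    Word : ℕ → PermSet G
    Word zero    p = p ≃ idP
    Word (suc k) p = Word k p ⊎ Any (λ a → Word k (p ⨾ invP a) ⊎ Word k (p ⨾ a)) gens

    word? : ∀ k → DecidablePermSet (Word k)
    word? k = record { respects = respects′ k ; decide = decide′ k }
      where
      respects′ : ∀ k → Respects≃ (Word k)
      respects′ zero    p≃q w        = ≃-trans (≃-sym p≃q) w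
      respects′ (suc k) p≃q (inj₁ w) = inj₁ (respects′ k p≃q w)
      respects′ (suc k) p≃q (inj₂ w) = inj₂ (Any.map (λ {a} →
        Sum.map (respects′ k (⨾-cong p≃q (≃-refl {invP a}))) (respects′ k (⨾-cong p≃q (≃-refl {a})))) w)
      decide′ : ∀ k → Decidable (Word k)
      decide′ zero    p = p ≃? idP
      decide′ (suc k) p = decide′ k p ⊎-dec Any.any? (λ a → decide′ k (p ⨾ invP a) ⊎-dec decide′ k (p ⨾ a)) gens

    Word-suc-mono : ∀ {j k} → Word j ⊆ Word k → Word (suc j) ⊆ Word (suc k)
    Word-suc-mono Wj⊆Wk (inj₁ w) = inj₁ (Wj⊆Wk w)
    Word-suc-mono Wj⊆Wk (inj₂ w) = inj₂ (Any.map (Sum.map Wj⊆Wk Wj⊆Wk) w)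

    Word-≤′ : ∀ {j k} → j ≤′ k → Word j ⊆ Word k
    Word-≤′ ≤′-refl        = λ w → w
    Word-≤′ (≤′-step j≤′k) = inj₁ ∘ Word-≤′ j≤′k

    Word-stalls : Word (suc (length allPerms)) ⊆ Word (length allPerms)
    Word-stalls = Word-≤′ (ℕ.≤⇒≤′ k≤N) ∘ bounded (suc (length allPerms))
      where
      stall : ∃[ k ] k ≤ length allPerms × Word (suc k) ⊆ Word k
      stall = ascending-chain-stalls word? (λ k → inj₁)
      k : ℕ
      k = proj₁ stall
      k≤N : k ≤ length allPerms
      k≤N = proj₁ (proj₂ stall)
      bounded : ∀ j → Word j ⊆ Word k
      bounded zero    = Word-≤′ ℕ.z≤′n
      bounded (suc j) = proj₂ (proj₂ stall) ∘ Word-suc-mono (bounded j)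

    Subgroup : PermSet G
    Subgroup = Word (length allPerms)

    subgroup? : DecidablePermSet Subgroup
    subgroup? = word? _

    ⨾-gen : ∀ {p a} → Subgroup p → a ∈ gens → Subgroup (p ⨾ a)
    ⨾-gen {p} {a} sp a∈gens = Word-stalls (inj₂ (Any.map (λ { refl →
      inj₁ (respects subgroup? (mk≃ (λ x → sym (from-to a (to p x))))  sp) }) a∈gens))

    ⨾-gen⁻¹ : ∀ {p a} → Subgroup p → a ∈ gens → Subgroup (p ⨾ invP a)
    ⨾-gen⁻¹ {p} {a} sp a∈gens = Word-stalls (inj₂ (Any.map (λ { refl →
      inj₂ (respects subgroup? (mk≃ (λ x → sym (to-from a (to p x))))  sp) }) a∈gens))

    id∈ : Subgroup idP
    id∈ = Word-≤′ ℕ.z≤′n ≃-refl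

    gen∈ : ∀ {a} → a ∈ gens → Subgroup a
    gen∈ a∈gens = respects subgroup? (mk≃ (λ _ → refl)) (⨾-gen id∈ a∈gens)

    ⨾∈ : ∀ {p q} k → Subgroup p → Word k q → Subgroup (p ⨾ q)
    ⨾∈ {p} {q} zero    sp q≃id     = respects subgroup? (mk≃ (λ x → sym (pointwise q≃id (to p x)))) sp
    ⨾∈         (suc k) sp (inj₁ w) = ⨾∈ k sp w
    ⨾∈ {p} {q} (suc k) sp (inj₂ w) with find w
    ... | a , a∈gens , inj₁ w′ =
      respects subgroup? (mk≃ (λ x → to-from a (to q (to p x)))) (⨾-gen (⨾∈ k sp w′) a∈gens)
    ... | a , a∈gens , inj₂ w′ =
      respects subgroup? (mk≃ (λ x → from-to a (to q (to p x)))) (⨾-gen⁻¹ (⨾∈ k sp w′) a∈gens)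

    invP∈ : ∀ {q} k → Word k q → Subgroup (invP q)
    invP∈ {q} zero    q≃id     =
      respects subgroup? (mk≃ (λ x → sym (trans (cong (from q) (sym (pointwise q≃id x))) (from-to q x)))) id∈
    invP∈     (suc k) (inj₁ w) = invP∈ k w
    invP∈ {q} (suc k) (inj₂ w) with find w
    ... | a , a∈gens , inj₁ w′ = respects subgroup? (mk≃ (λ x → cong (from q) (to-from a x)))
      (⨾∈ (length allPerms) (⨾-gen⁻¹ id∈ a∈gens) (invP∈ k w′))
    ... | a , a∈gens , inj₂ w′ = respects subgroup? (mk≃ (λ x → cong (from q) (from-to a x)))
      (⨾∈ (length allPerms) (gen∈ a∈gens) (invP∈ k w′))

    subgroup-isPermGroup : IsPermGroup G Subgroup
    subgroup-isPermGroup = record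
      { resp≈ = respects subgroup? ∘ mk≃
      ; id∈   = id∈
      ; ⨾∈    = ⨾∈ (length allPerms)
      ; inv∈  = invP∈ (length allPerms) }

    subgroup-least : {B : PermSet G} → IsPermGroup G B → (∀ {a} → a ∈ gens → B a) → ∀ k → Word k ⊆ B
    subgroup-least B-group gens⊆B zero    q≃id     = IsPermGroup.resp≈ B-group (pointwise (≃-sym q≃id)) (IsPermGroup.id∈ B-group)
    subgroup-least B-group gens⊆B (suc k) (inj₁ w) = subgroup-least B-group gens⊆B k w
    subgroup-least B-group gens⊆B (suc k) (inj₂ w) with find w
    ... | a , a∈gens , inj₁ w′ = IsPermGroup.resp≈ B-group (λ x → to-from a _)
      (IsPermGroup.⨾∈ B-group (subgroup-least B-group gens⊆B k w′) (gens⊆B a∈gens))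
    ... | a , a∈gens , inj₂ w′ = IsPermGroup.resp≈ B-group (λ x → from-to a _)
      (IsPermGroup.⨾∈ B-group (subgroup-least B-group gens⊆B k w′) (IsPermGroup.inv∈ B-group (gens⊆B a∈gens)))

  ρs : List Permutation
  ρs = map (ρ G ∘ enum) (allFin size)

  ⟨_⟩ : List Permutation → PermSet G
  ⟨ L ⟩ = Generated.Subgroup (L ++ ρs)

  ⟨⟩? : ∀ L → DecidablePermSet ⟨ L ⟩
  ⟨⟩? L = Generated.subgroup? (L ++ ρs)

  ⟨⟩-inSup : ∀ L → InSup G ⟨ L ⟩
  ⟨⟩-inSup L = Generated.subgroup-isPermGroup (L ++ ρs) , λ g →
    respects (⟨⟩? L) (mk≃ (λ x → cong (x ∙_) (enum-index g)))
      (Generated.gen∈ (L ++ ρs) (∈-++⁺ʳ L (∈-map⁺ (ρ G ∘ enum) (∈-allFin (index g)))))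

  ∈⟨⟩ : ∀ {L p q} → q ∈ L → p ≃ q → ⟨ L ⟩ p
  ∈⟨⟩ {L} q∈L p≃q = respects (⟨⟩? L) (≃-sym p≃q) (Generated.gen∈ (L ++ ρs) (∈-++⁺ˡ q∈L))

  ⟨⟩-least : ∀ {L B} → InSup G B → (∀ {q} → q ∈ L → B q) → ⟨ L ⟩ ⊆ B
  ⟨⟩-least {L} {B} (B-group , ρ∈B) L⊆B = Generated.subgroup-least (L ++ ρs) B-group gens⊆B (length allPerms)
    where
    gens⊆B : ∀ {a} → a ∈ L ++ ρs → B a
    gens⊆B a∈ with ∈-++⁻ L a∈
    ... | inj₁ a∈L  = L⊆B a∈L
    ... | inj₂ a∈ρs with ∈-map⁻ (ρ G ∘ enum) a∈ρs
    ...   | i , _ , refl = ρ∈B (enum i)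

  module Minimisation {B₀ : PermSet G} (dB₀ : DecidablePermSet B₀) (B₀∈Sup : InSup G B₀) where

    Candidate : List Permutation → Set
    Candidate L = ⟨ L ⟩ ⪯ᴳ B₀

    candidate? : Decidable Candidate
    candidate? L = ⪯? (⟨⟩? L) dB₀

    L₀ : List Permutation
    L₀ = filter (decide dB₀) allPerms

    B₀⊆⟨L₀⟩ : B₀ ⊆ ⟨ L₀ ⟩
    B₀⊆⟨L₀⟩ {p} B₀p with find (allPerms-complete p)
    ... | q , q∈allPerms , p≃q = ∈⟨⟩ (∈-filter⁺ (decide dB₀) q∈allPerms (respects dB₀ p≃q B₀p)) p≃q

    L₀-candidate : Candidate L₀
    L₀-candidate = (λ _ → ⟨⟩-least B₀∈Sup (λ q∈L₀ → proj₂ (∈-filter⁻ (decide dB₀) {xs = allPerms} q∈L₀))) , λ φ GR≤B₀ →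
      idP , IsPermGroup.id∈ (proj₁ B₀∈Sup) , λ g → B₀⊆⟨L₀⟩ (respects dB₀ (mk≃ (λ _ → refl)) (GR≤B₀ g))

    minimiser : ∃[ L ] Candidate L × (∀ L′ → L′ ∈ sublists allPerms → Candidate L′ → ∣ ⟨⟩? L ∣ ≤ ∣ ⟨⟩? L′ ∣)
    minimiser = argmin-satisfying (λ L → ∣ ⟨⟩? L ∣) candidate? L₀-candidate (sublists allPerms)

    A : PermSet G
    A = ⟨ proj₁ minimiser ⟩

    A? : DecidablePermSet A
    A? = ⟨⟩? (proj₁ minimiser)

    A⪯B₀ : A ⪯ᴳ B₀
    A⪯B₀ = proj₁ (proj₂ minimiser)

    A-smallest : ∀ L → L ∈ sublists allPerms → Candidate L → ∣ A? ∣ ≤ ∣ ⟨⟩? L ∣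
    A-smallest = proj₂ (proj₂ minimiser)

    module _ {B : PermSet G} (B∈Sup : InSup G B) (B⪯A : B ⪯ᴳ A) where

      private
        correction : ∀ φ → Dec (GR^ φ ≤ᴳ A) → Permutation
        correction φ (yes GR≤A) = proj₁ (proj₂ B⪯A φ GR≤A)
        correction φ (no _)     = idP

        correction-lifts : ∀ φ d → GR^ φ ≤ᴳ A → A (correction φ d) × GR^ (φ ⨾ correction φ d) ≤ᴳ B
        correction-lifts φ (yes GR≤A) _    = proj₂ (proj₂ B⪯A φ GR≤A)
        correction-lifts φ (no ¬GR≤A) GR≤A = ⊥-elim (¬GR≤A GR≤A)

        ψ : Permutation → Permutation
        ψ φ = correction φ (GR≤? A? φ)

        ψ-lifts : ∀ φ → GR^ φ ≤ᴳ A → A (ψ φ) × GR^ (φ ⨾ ψ φ) ≤ᴳ B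
        ψ-lifts φ = correction-lifts φ (GR≤? A? φ)

        Conjugator : Permutation → Permutation → Set
        Conjugator q φ = GR^ φ ≤ᴳ A × ∃[ g ] q ≃ conj (φ ⨾ ψ φ) (ρ G g)

        Conjugate : PermSet G
        Conjugate q = Any (Conjugator q) allPerms

        conjugate? : Decidable Conjugate
        conjugate? q = Any.any? (λ φ → GR≤? A? φ ×-dec ∃? (λ g → q ≃? conj (φ ⨾ ψ φ) (ρ G g))) allPerms

        L′ : List Permutation
        L′ = filter conjugate? allPerms

        conjugator⇒B : ∀ {q φ} → Conjugator q φ → B q
        conjugator⇒B {q} {φ} (GR≤A , g , q≃conj) =
          group-respects (proj₁ B∈Sup) {conj (φ ⨾ ψ φ) (ρ G g)} {q} (≃-sym q≃conj) (proj₂ (ψ-lifts φ GR≤A) g)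

        conjugate⇒B : Conjugate ⊆ B
        conjugate⇒B {q} c = conjugator⇒B {q} {proj₁ (Any.satisfied c)} (proj₂ (Any.satisfied c))

        L′⊆B : ∀ {q} → q ∈ L′ → B q
        L′⊆B q∈L′ = conjugate⇒B (proj₂ (∈-filter⁻ conjugate? {xs = allPerms} q∈L′))

        ⟨L′⟩⊆B : ⟨ L′ ⟩ ⊆ B
        ⟨L′⟩⊆B = ⟨⟩-least B∈Sup L′⊆B

        conjugate-respects : Respects≃ Conjugate
        conjugate-respects {p} {q} p≃q = Any.map {P = Conjugator p} {Q = Conjugator q}
          (λ (GR≤A , g , p≃c) → GR≤A , g , ≃-trans (≃-sym p≃q) p≃c)

        conjugate⇒⟨L′⟩ : Conjugate ⊆ ⟨ L′ ⟩
        conjugate⇒⟨L′⟩ {c} cc =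
          let q , q∈allPerms , c≃q = find (allPerms-complete c)
          in ∈⟨⟩ (∈-filter⁺ conjugate? q∈allPerms (conjugate-respects c≃q cc)) c≃q

        lift-via : ∀ {φ φ₀} → φ₀ ∈ allPerms → φ ≃ φ₀ → GR^ φ₀ ≤ᴳ A → ∃[ ψ′ ] A ψ′ × GR^ (φ ⨾ ψ′) ≤ᴳ ⟨ L′ ⟩
        lift-via {φ} {φ₀} φ₀∈allPerms φ≃φ₀ GR≤A₀ = ψ φ₀ , proj₁ (ψ-lifts φ₀ GR≤A₀) , λ g →
          conjugate⇒⟨L′⟩ (lose {P = Conjugator (conj (φ ⨾ ψ φ₀) (ρ G g))} φ₀∈allPerms
            (GR≤A₀ , g , conj-cong (⨾-cong φ≃φ₀ (≃-refl {ψ φ₀})) (≃-refl {ρ G g})))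

        ⟨L′⟩⪯A : ⟨ L′ ⟩ ⪯ᴳ A
        ⟨L′⟩⪯A = (λ p → proj₁ B⪯A p ∘ ⟨L′⟩⊆B {p}) , λ φ GR≤A →
          let φ₀ , φ₀∈allPerms , φ≃φ₀ = find (allPerms-complete φ)
          in lift-via {φ} {φ₀} φ₀∈allPerms φ≃φ₀ (GR≤-respects A? φ≃φ₀ GR≤A)

      A⊆B : _⊆ₚ_ G A B
      A⊆B p Ap = ⟨L′⟩⊆B {p} (⊆-by-∣∣ (⟨⟩? L′) A? (λ {q} → proj₁ ⟨L′⟩⪯A q) ∣A∣≤∣⟨L′⟩∣ {p} Ap)
        where
        ∣A∣≤∣⟨L′⟩∣ : ∣ A? ∣ ≤ ∣ ⟨⟩? L′ ∣
        ∣A∣≤∣⟨L′⟩∣ = A-smallest L′ (filter∈sublists conjugate? allPerms)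
                                (⪯-trans (⟨⟩? L′) (proj₁ B₀∈Sup) ⟨L′⟩⪯A A⪯B₀)

    A-SupMin : SupMin G A
    A-SupMin = ⟨⟩-inSup (proj₁ minimiser) , λ _ → A⊆B

  SupMin-below : ∀ {B₀} → DecidablePermSet B₀ → InSup G B₀ →
    Σ (PermSet G) λ A → SupMin G A × A ⪯ᴳ B₀ × DecidablePermSet A
  SupMin-below dB₀ B₀∈Sup = A , A-SupMin , A⪯B₀ , A?
    where open Minimisation dB₀ B₀∈Sup

  -- Cayley isomorphisms

  arc⇔ : ∀ (X : Carrier → Set) u v → Arc G X u v ⇔ X (v ∙ u ⁻¹)
  arc⇔ X u v = mk⇔ (λ { (x , Xx , refl) → subst X (sym (//-rightDividesʳ u x)) Xx })
                   (λ X[vu⁻¹] → v ∙ u ⁻¹ , X[vu⁻¹] , sym (//-rightDividesˡ u v))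

  module _ {X Y : Carrier → Set} where

    cayIso-respects : ∀ {p q} → p ≃ q → IsCayIso G p X Y → IsCayIso G q X Y
    cayIso-respects (mk≃ p≈q) iso u v = ⇔.trans (iso u v) (≡⇒⇔ (λ (u′ , v′) → Arc G Y u′ v′) (cong₂ _,_ (p≈q u) (p≈q v)))

    cayIso-invP : ∀ {p} → IsCayIso G p X Y → IsCayIso G (invP p) Y X
    cayIso-invP {p} iso u v = ⇔.sym (⇔.trans (iso (from p u) (from p v))
      (≡⇒⇔ (λ (u′ , v′) → Arc G Y u′ v′) (cong₂ _,_ (to-from p u) (to-from p v))))

    cayIso-⨾ : ∀ {p q} {Z : Carrier → Set} → IsCayIso G p X Y → IsCayIso G q Y Z → IsCayIso G (p ⨾ q) X Z
    cayIso-⨾ {p} p-iso q-iso u v = ⇔.trans (p-iso u v) (q-iso (to p u) (to p v))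

  cayIso-ρ : ∀ {X} g → IsCayIso G (ρ G g) X X
  cayIso-ρ {X} g u v = ⇔.trans (arc⇔ X u v) (⇔.trans (≡⇒⇔ X (sym (right-translation-invariant u v g)))
                                                      (⇔.sym (arc⇔ X (u ∙ g) (v ∙ g))))
    where
    right-translation-invariant : ∀ u v g → (v ∙ g) ∙ (u ∙ g) ⁻¹ ≡ v ∙ u ⁻¹
    right-translation-invariant u v g = begin
      (v ∙ g) ∙ (u ∙ g) ⁻¹    ≡⟨ cong ((v ∙ g) ∙_) (⁻¹-anti-homo-∙ u g) ⟩
      (v ∙ g) ∙ (g ⁻¹ ∙ u ⁻¹) ≡⟨ sym (assoc (v ∙ g) (g ⁻¹) (u ⁻¹)) ⟩
      ((v ∙ g) ∙ g ⁻¹) ∙ u ⁻¹ ≡⟨ cong (_∙ u ⁻¹) (//-rightDividesʳ g v) ⟩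
      v ∙ u ⁻¹                ∎
      where open ≡-Reasoning

  Connection : (Carrier → Bool) → Carrier → Set
  Connection S x = S x ≡ true

  CayAut : (Carrier → Bool) → PermSet G
  CayAut S p = IsCayIso G p (Connection S) (Connection S)

  cayAut? : ∀ S → DecidablePermSet (CayAut S)
  cayAut? S = record
    { respects = cayIso-respects
    ; decide   = λ p → ∀? (λ u → ∀? (λ v → arc? u v ⇔? arc? (to p u) (to p v))) }
    where
    arc? : ∀ u v → Dec (Arc G (Connection S) u v)
    arc? u v = Dec.map (⇔.sym (arc⇔ (Connection S) u v)) (S (v ∙ u ⁻¹) Bool.≟ true)
    _⇔?_ : ∀ {P Q : Set} → Dec P → Dec Q → Dec (P ⇔ Q)
    P? ⇔? Q? = Dec.map′ (λ (f , g) → mk⇔ f g) (λ e → Equivalence.to e , Equivalence.from e) ((P? →-dec Q?) ×-dec (Q? →-dec P?))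

  cayAut-inSup : ∀ S → InSup G (CayAut S)
  cayAut-inSup S = record
    { resp≈ = λ {p} {q} p≈q → cayIso-respects {p = p} {q} (mk≃ p≈q)
    ; id∈   = λ u v → ⇔.refl
    ; ⨾∈    = λ {p} {q} → cayIso-⨾ {p = p} {q}
    ; inv∈  = λ {p} → cayIso-invP {p = p} } , cayIso-ρ

  -- Orbit S-rings

  Orbit : PermSet G → Carrier → Carrier → Set
  Orbit A x y = ∃[ a ] A a × to a ε ≡ ε × to a x ≡ y

  orbit-isEquivalence : ∀ {A} → IsPermGroup G A → IsEquivalence (Orbit A)
  orbit-isEquivalence A-group = record
    { refl  = idP , IsPermGroup.id∈ A-group , refl , refl
    ; sym   = λ (a , Aa , aε≡ε , ax≡y) → invP a , IsPermGroup.inv∈ A-group Aa , from-fixes a aε≡ε , from-fixes a ax≡y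
    ; trans = λ (a , Aa , aε≡ε , ax≡y) (b , Ab , bε≡ε , by≡z) →
        a ⨾ b , IsPermGroup.⨾∈ A-group Aa Ab , trans (cong (to b) aε≡ε) bε≡ε , trans (cong (to b) ax≡y) by≡z }
    where
    from-fixes : ∀ a {x y} → to a x ≡ y → from a y ≡ x
    from-fixes a {x} refl = from-to a x

  orbit-partition : ∀ {A} → IsPermGroup G A → DecidablePermSet A → ∃[ r ] Σ (Partition G r) (IsOrbitPartition G A)
  orbit-partition {A} A-group A? = rank , P , λ x y →
    ⇔.trans (class-≡⇔ (index x) (index y)) (≡⇒⇔ (λ (x′ , y′) → Orbit A x′ y′) (cong₂ _,_ (enum-index x) (enum-index y)))
    where
    orbit? : ∀ x y → Dec (Orbit A x y)
    orbit? x y = ∃-perm? (λ a≃b (Aa , aε≡ε , ax≡y) → respects A? a≃b Aa ,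
                            trans (sym (pointwise a≃b ε)) aε≡ε , trans (sym (pointwise a≃b x)) ax≡y)
                         (λ a → decide A? a ×-dec to a ε ≟ ε ×-dec to a x ≟ y)
    open Quotient (quotient (On.isEquivalence enum (orbit-isEquivalence A-group)) (λ i j → orbit? (enum i) (enum j)))
    P : Partition G rank
    P = record { colour = class ∘ index
               ; nonempty = λ k → let i , e = class-surjective k in enum i , trans (cong class (index-enum i)) e }

  divisorsOf : Carrier → Permutation
  divisorsOf z = record
    { to      = λ y → z ∙ y ⁻¹
    ; from    = λ w → w ⁻¹ ∙ z
    ; to-from = λ w → trans (cong (z ∙_) (trans (⁻¹-anti-homo-∙ (w ⁻¹) z) (cong (z ⁻¹ ∙_) (⁻¹-involutive w))))
                            (\\-leftDividesˡ z w)
    ; from-to = λ y → trans (cong (_∙ z) (trans (⁻¹-anti-homo-∙ z (y ⁻¹)) (cong (_∙ z ⁻¹) (⁻¹-involutive y))))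
                            (//-rightDividesˡ z y) }

  convolution-by-divisors : ∀ f g z → _*ZG_ G f g z ≡ sumFin (λ k → f (z ∙ enum k ⁻¹) * g (enum k))
  convolution-by-divisors f g z = trans (sum-reindex (λ x → f x * g (x ⁻¹ ∙ z)) (divisorsOf z))
    (sumFin-cong (λ k → cong (f (z ∙ enum k ⁻¹) *_) (cong g (from-to (divisorsOf z) (enum k)))))

  module OrbitSRing {A : PermSet G} (A∈Sup : InSup G A) {r} (P : Partition G r)
                    (orbits : IsOrbitPartition G A P) where
    open Partition P
    open IsPermGroup (proj₁ A∈Sup)

    orbit⇒colour : ∀ {x y} → Orbit A x y → colour x ≡ colour y
    orbit⇒colour = Equivalence.from (orbits _ _)

    colour⇒orbit : ∀ {x y} → colour x ≡ colour y → Orbit A x y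
    colour⇒orbit = Equivalence.to (orbits _ _)

    colour-quotient : ∀ {a} → A a → to a ε ≡ ε → ∀ z y → colour (z ∙ y ⁻¹) ≡ colour (to a z ∙ to a y ⁻¹)
    colour-quotient {a} Aa aε≡ε z y = orbit⇒colour
      ( ρ G y ⨾ a ⨾ ρ G (to a y ⁻¹) , ⨾∈ (⨾∈ (proj₂ A∈Sup y) Aa) (proj₂ A∈Sup _)
      , trans (cong (λ t → to a t ∙ to a y ⁻¹) (identityˡ y)) (inverseʳ (to a y))
      , cong (λ t → to a t ∙ to a y ⁻¹) (//-rightDividesˡ y z) )

    colour-⁻¹ : ∀ {u v} → colour u ≡ colour v → colour (u ⁻¹) ≡ colour (v ⁻¹)
    colour-⁻¹ {u} {v} cu≡cv = let a , Aa , aε≡ε , au≡v = colour⇒orbit cu≡cv in begin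
      colour (u ⁻¹)                 ≡⟨ cong colour (sym (identityˡ (u ⁻¹))) ⟩
      colour (ε ∙ u ⁻¹)             ≡⟨ colour-quotient Aa aε≡ε ε u ⟩
      colour (to a ε ∙ to a u ⁻¹)   ≡⟨ cong₂ (λ s t → colour (s ∙ t ⁻¹)) aε≡ε au≡v ⟩
      colour (ε ∙ v ⁻¹)             ≡⟨ cong colour (identityˡ (v ⁻¹)) ⟩
      colour (v ⁻¹)                 ∎
      where open ≡-Reasoning

    colour-ε : ∀ x → colour x ≡ colour ε ⇔ x ≡ ε
    colour-ε x = mk⇔ (λ cx≡cε → let a , _ , aε≡ε , ax≡ε = colour⇒orbit cx≡cε in
                        trans (sym (from-to a x)) (trans (cong (from a) (trans ax≡ε (sym aε≡ε))) (from-to a ε)))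
                     (λ { refl → refl })

    ClassFunction : ZG G → Set
    ClassFunction f = ∀ {z z′} → colour z ≡ colour z′ → f z ≡ f z′

    span⇒class : ∀ {f} → InSpan G P f → ClassFunction f
    span⇒class {f} (c , f≡) {z} {z′} cz≡cz′ =
      trans (f≡ z) (trans (cong (λ k → sumFin (λ i → c i * indicator (k Fin.≟ i))) cz≡cz′) (sym (f≡ z′)))

    class⇒span : ∀ {f} → ClassFunction f → InSpan G P f
    class⇒span {f} f-class = (λ i → f (proj₁ (nonempty i))) , λ z →
      sym (trans (sumFin-indicator (λ i → f (proj₁ (nonempty i))) (colour z)) (f-class (proj₂ (nonempty (colour z)))))

    one-class : ClassFunction (oneZG G)
    one-class {z} {z′} cz≡cz′ = cong (λ b → if b then 1ℤ else 0ℤ) (begin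
      ⌊ _≟G_ G z ε ⌋   ≡⟨ Dec.isYes≗does _ ⟩
      does (_≟G_ G z ε) ≡⟨ does-⇔ z≡ε⇔z′≡ε (_≟G_ G z ε) (_≟G_ G z′ ε) ⟩
      does (_≟G_ G z′ ε) ≡⟨ sym (Dec.isYes≗does _) ⟩
      ⌊ _≟G_ G z′ ε ⌋  ∎)
      where
      open ≡-Reasoning
      z≡ε⇔z′≡ε : z ≡ ε ⇔ z′ ≡ ε
      z≡ε⇔z′≡ε = ⇔.trans (⇔.sym (colour-ε z)) (⇔.trans (mk⇔ (trans (sym cz≡cz′)) (trans cz≡cz′)) (colour-ε z′))

    convolution-class : ∀ {f g} → ClassFunction f → ClassFunction g → ClassFunction (_*ZG_ G f g)
    convolution-class {f} {g} f-class g-class {z} {z′} cz≡cz′ = let a , Aa , aε≡ε , az≡z′ = colour⇒orbit cz≡cz′ in begin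
      _*ZG_ G f g z                                                 ≡⟨ convolution-by-divisors f g z ⟩
      sumFin (λ k → f (z ∙ enum k ⁻¹) * g (enum k))                 ≡⟨ sumFin-cong (λ k → cong₂ _*_
                                                                         (f-class (colour-quotient Aa aε≡ε z (enum k)))
                                                                         (g-class (orbit⇒colour (a , Aa , aε≡ε , refl)))) ⟩
      sumFin (λ k → f (to a z ∙ to a (enum k) ⁻¹) * g (to a (enum k))) ≡⟨ sym (sum-reindex (λ y → f (to a z ∙ y ⁻¹) * g y) a) ⟩
      sumFin (λ k → f (to a z ∙ enum k ⁻¹) * g (enum k))            ≡⟨ cong (λ t → sumFin (λ k → f (t ∙ enum k ⁻¹) * g (enum k))) az≡z′ ⟩
      sumFin (λ k → f (z′ ∙ enum k ⁻¹) * g (enum k))                ≡⟨ sym (convolution-by-divisors f g z′) ⟩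
      _*ZG_ G f g z′                                                ∎
      where open ≡-Reasoning

    orbit-isSRing : IsSRing G P
    orbit-isSRing = (colour ε , colour-ε)
                  , (λ i → colour (rep i ⁻¹) , λ y → mk⇔
                      (λ cy≡ → trans (colour-⁻¹ cy≡) (trans (cong colour (⁻¹-involutive (rep i))) (rep-colour i)))
                      (λ cy⁻¹≡i → trans (cong colour (sym (⁻¹-involutive y))) (colour-⁻¹ (trans cy⁻¹≡i (sym (rep-colour i))))))
                  , class⇒span one-class
                  , class⇒span (λ _ → refl)
                  , (λ f g f∈ g∈ → class⇒span (λ e → cong₂ _+_ (span⇒class f∈ e) (span⇒class g∈ e)))
                  , (λ f f∈ → class⇒span (λ e → cong -_ (span⇒class f∈ e)))
                  , (λ f g f∈ g∈ → class⇒span (convolution-class (span⇒class f∈) (span⇒class g∈)))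
      where
      rep : Fin r → Carrier
      rep i = proj₁ (nonempty i)
      rep-colour : ∀ i → colour (rep i) ≡ i
      rep-colour i = proj₂ (nonempty i)

  -- Transferring an isomorphism of Cayley digraphs to the orbit S-rings

  cayIso⇒GR≤ : ∀ {X Y φ} → IsCayIso G φ X Y → GR^ (invP φ) ≤ᴳ (λ p → IsCayIso G p X X)
  cayIso⇒GR≤ {φ = φ} iso g = cayIso-⨾ {p = φ ⨾ ρ G g} {invP φ} (cayIso-⨾ {p = φ} {ρ G g} iso (cayIso-ρ g)) (cayIso-invP {p = φ} iso)

  GR≤-conjugate : ∀ {A} → Respects≃ A → ∀ {φ} c → GR^ φ ≤ᴳ A → GR^ (invP (ρ G c) ⨾ φ) ≤ᴳ A
  GR≤-conjugate A-respects {φ} c GR≤A g = A-respects (mk≃ (λ x → cong (to φ) (reassociate (from φ x)))) (GR≤A (c ∙ g ∙ c ⁻¹))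
    where
    reassociate : ∀ y → y ∙ (c ∙ g ∙ c ⁻¹) ≡ y ∙ c ∙ g ∙ c ⁻¹
    reassociate y = begin
      y ∙ (c ∙ g ∙ c ⁻¹)   ≡⟨ cong (y ∙_) (assoc c g (c ⁻¹)) ⟩
      y ∙ (c ∙ (g ∙ c ⁻¹)) ≡⟨ sym (assoc y c (g ∙ c ⁻¹)) ⟩
      y ∙ c ∙ (g ∙ c ⁻¹)   ≡⟨ sym (assoc (y ∙ c) g (c ⁻¹)) ⟩
      y ∙ c ∙ g ∙ c ⁻¹     ∎
      where open ≡-Reasoning

  normalised-cayIso : ∀ {X Y A φ} → IsPermGroup G A → A ⪯ᴳ (λ p → IsCayIso G p X X) → IsCayIso G φ X Y →
    ∃[ φ′ ] IsCayIso G φ′ X Y × to φ′ ε ≡ ε × GR^ (invP φ′) ≤ᴳ A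
  normalised-cayIso {X} {Y} {A} {φ} A-group (_ , lift) φ-iso =
    φ₁ ⨾ ρ G c , cayIso-⨾ {p = φ₁} {ρ G c} φ₁-iso (cayIso-ρ c) , inverseʳ (to φ₁ ε) ,
    λ g → group-respects A-group (mk≃ (λ _ → refl)) (GR≤-conjugate (group-respects A-group) {invP φ₁} c GR≤A g)
    where
    lifted : ∃[ ψ ] IsCayIso G ψ X X × GR^ (invP φ ⨾ ψ) ≤ᴳ A
    lifted = lift (invP φ) (cayIso⇒GR≤ {φ = φ} φ-iso)
    ψ : Permutation
    ψ = proj₁ lifted
    φ₁ : Permutation
    φ₁ = invP ψ ⨾ φ
    φ₁-iso : IsCayIso G φ₁ X Y
    φ₁-iso = cayIso-⨾ {p = invP ψ} {φ} (cayIso-invP {p = ψ} (proj₁ (proj₂ lifted))) φ-iso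
    GR≤A : GR^ (invP φ₁) ≤ᴳ A
    GR≤A g = group-respects A-group (mk≃ (λ _ → refl)) (proj₂ (proj₂ lifted) g)
    c : Carrier
    c = to φ₁ ε ⁻¹

  module Transport {A : PermSet G} (A∈Sup : InSup G A) {r} (P : Partition G r) (orbits : IsOrbitPartition G A P)
                   {φ : Permutation} (φε≡ε : to φ ε ≡ ε) (GR≤A : GR^ (invP φ) ≤ᴳ A) where
    open IsPermGroup (proj₁ A∈Sup)
    open Partition P using (colour)

    private
      A-respects : Respects≃ A
      A-respects = group-respects (proj₁ A∈Sup)

      φ⁻¹ε≡ε : from φ ε ≡ ε
      φ⁻¹ε≡ε = trans (cong (from φ) (sym φε≡ε)) (from-to φ ε)

    Aᵠ : PermSet G
    Aᵠ p = A (φ ⨾ p ⨾ invP φ)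

    Aᵠ∈Sup : InSup G Aᵠ
    Aᵠ∈Sup = record
      { resp≈ = λ {p} {q} p≈q → A-respects (⨾-cong (⨾-cong (≃-refl {φ}) (mk≃ {p} {q} p≈q)) (≃-refl {invP φ}))
      ; id∈   = A-respects (mk≃ (λ x → sym (from-to φ x))) id∈
      ; ⨾∈    = λ {p} {q} Aᵠp Aᵠq → A-respects (mk≃ (λ x → cong (from φ ∘ to q) (to-from φ _))) (⨾∈ Aᵠp Aᵠq)
      ; inv∈  = A-respects (mk≃ (λ _ → refl)) ∘ inv∈ }
      , λ g → A-respects (mk≃ (λ _ → refl)) (GR≤A g)

    Q : Partition G r
    Q = record { colour   = colour ∘ from φ
               ; nonempty = λ k → let x , cx≡k = Partition.nonempty P k in to φ x , trans (cong colour (from-to φ x)) cx≡k }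

    Q-orbits : IsOrbitPartition G Aᵠ Q
    Q-orbits x y = ⇔.trans (orbits (from φ x) (from φ y)) (mk⇔
      (λ (a , Aa , aε≡ε , ax≡y) → invP φ ⨾ a ⨾ φ , A-respects (mk≃ (λ z → sym (trans (from-to φ _) (cong (to a) (from-to φ z))))) Aa
        , trans (cong (to φ ∘ to a) φ⁻¹ε≡ε) (trans (cong (to φ) aε≡ε) φε≡ε) , trans (cong (to φ) ax≡y) (to-from φ y))
      (λ (b , Aᵠb , bε≡ε , bx≡y) → φ ⨾ b ⨾ invP φ , Aᵠb
        , trans (cong (from φ ∘ to b) φε≡ε) (trans (cong (from φ) bε≡ε) φ⁻¹ε≡ε)
        , trans (cong (from φ ∘ to b) (to-from φ x)) (cong (from φ) bx≡y)))

    Q-isSRing : IsSRing G Q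
    Q-isSRing = OrbitSRing.orbit-isSRing Aᵠ∈Sup Q Q-orbits

    colour-transport : ∀ u v → colour (v ∙ u ⁻¹) ≡ colour (from φ (to φ v ∙ to φ u ⁻¹))
    colour-transport u v = Equivalence.from (orbits _ _)
      ( ρ G u ⨾ (φ ⨾ ρ G w ⨾ invP φ) , ⨾∈ (proj₂ A∈Sup u) (proj₂ Aᵠ∈Sup w)
      , trans (cong (λ t → from φ (to φ t ∙ w)) (identityˡ u)) (trans (cong (from φ) (inverseʳ (to φ u))) φ⁻¹ε≡ε)
      , cong (λ t → from φ (to φ t ∙ w)) (//-rightDividesˡ u v) )
      where
      w : Carrier
      w = to φ u ⁻¹

    φ-isSRingIso : IsSRingIso G P Q φ
    φ-isSRingIso = idP , λ i u v → ⇔.trans (arc⇔ (Basic G P i) u v)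
      (⇔.trans (≡⇒⇔ (_≡ i) (colour-transport u v)) (⇔.sym (arc⇔ (Basic G Q i) (to φ u) (to φ v))))

  arc-from-ε : ∀ (X : Carrier → Set) x → Arc G X ε x ⇔ X x
  arc-from-ε X x = ⇔.trans (arc⇔ X ε x) (≡⇒⇔ X (trans (cong (x ∙_) ε⁻¹≈ε) (identityʳ x)))

  module _ {S : Carrier → Bool} {A : PermSet G} {r} {P : Partition G r} where
    open Partition P using (colour)

    connection-class : _⊆ₚ_ G A (CayAut S) → IsOrbitPartition G A P →
      ∀ {x y} → colour x ≡ colour y → S x ≡ S y
    connection-class A⊆Aut orbits {x} {y} cx≡cy =
      let a , Aa , aε≡ε , ax≡y = Equivalence.to (orbits x y) cx≡cy in
      ≡true-injective (begin
        S x ≡ true           ≈⟨ arc-from-ε (Connection S) x ⟨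
        Arc G (Connection S) ε x ≈⟨ A⊆Aut a Aa ε x ⟩
        Arc G (Connection S) (to a ε) (to a x) ≈⟨ ≡⇒⇔ (λ (u , v) → Arc G (Connection S) u v) (cong₂ _,_ aε≡ε ax≡y) ⟩
        Arc G (Connection S) ε y ≈⟨ arc-from-ε (Connection S) y ⟩
        S y ≡ true           ∎)
      where open SetoidReasoning (⇔.⇔-setoid 0ℓ)

    connection-sets-related : ∀ {T φ α β} → (∀ {x y} → colour x ≡ colour y → S x ≡ S y) →
      IsCayIso G φ (Connection S) (Connection T) → InAutS G P α → IsGroupAut G β → φ ≈ₚ (α ⨾ β) →
      ∀ x → T (to β x) ≡ S x
    connection-sets-related {T} {φ} {α} {β} S-class φ-iso α-aut β-hom φ≈αβ x = sym (≡true-injective (begin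
      S x ≡ true                                ≈⟨ ≡⇒⇔ (λ t → S t ≡ true) x≡αu₁/αu₀ ⟩
      S (to α u₁ ∙ to α u₀ ⁻¹) ≡ true           ≈⟨ ≡⇒⇔ (λ t → t ≡ true) (α-preserves u₀ u₁) ⟨
      S (u₁ ∙ u₀ ⁻¹) ≡ true                     ≈⟨ arc⇔ (Connection S) u₀ u₁ ⟨
      Arc G (Connection S) u₀ u₁                ≈⟨ φ-iso u₀ u₁ ⟩
      Arc G (Connection T) (to φ u₀) (to φ u₁)  ≈⟨ ≡⇒⇔ (λ (u , v) → Arc G (Connection T) u v) (cong₂ _,_ φu₀≡ε φu₁≡βx) ⟩
      Arc G (Connection T) ε (to β x)           ≈⟨ arc-from-ε (Connection T) (to β x) ⟩
      T (to β x) ≡ true                         ∎))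
      where
      open SetoidReasoning (⇔.⇔-setoid 0ℓ)
      u₀ u₁ : Carrier
      u₀ = from α ε
      u₁ = from α x
      α-preserves : ∀ u v → S (v ∙ u ⁻¹) ≡ S (to α v ∙ to α u ⁻¹)
      α-preserves u v = S-class (sym (Equivalence.to (arc⇔ (Basic G P i) (to α u) (to α v))
                          (Equivalence.to (α-aut i u v) (Equivalence.from (arc⇔ (Basic G P i) u v) refl))))
        where
        i : Fin r
        i = colour (v ∙ u ⁻¹)
      x≡αu₁/αu₀ : x ≡ to α u₁ ∙ to α u₀ ⁻¹
      x≡αu₁/αu₀ = trans (sym (trans (cong (x ∙_) ε⁻¹≈ε) (identityʳ x)))
                        (cong₂ (λ s t → s ∙ t ⁻¹) (sym (to-from α x)) (sym (to-from α ε)))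
      βε≡ε : to β ε ≡ ε
      βε≡ε = identityˡ-unique (to β ε) (to β ε) (trans (sym (β-hom ε ε)) (cong (to β) (identityˡ ε)))
      φu₀≡ε : to φ u₀ ≡ ε
      φu₀≡ε = trans (φ≈αβ u₀) (trans (cong (to β) (to-from α ε)) βε≡ε)
      φu₁≡βx : to φ u₁ ≡ to β x
      φu₁≡βx = trans (φ≈αβ u₁) (cong (to β) (to-from α x))

corollary3p4 : (G : FinGroup) →
    (∀ (A : PermSet G) → SupMin G A →
    ∀ (r : ℕ) (P : Partition G r) → IsOrbitPartition G A P → IsCISRing G P) →
    IsDCI G
corollary3p4 G CI S T _ _ (φ , φ-iso) =
  let A , A-SupMin , A⪯Aut , A? = SupMin-below G (cayAut? G S) (cayAut-inSup G S)
      A-group = proj₁ (proj₁ A-SupMin)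
      φ′ , φ′-iso , φ′ε≡ε , GR≤A = normalised-cayIso G {Connection G S} {Connection G T} {A} {φ} A-group A⪯Aut φ-iso
      r , P , orbits = orbit-partition G A-group A?
      open Transport G (proj₁ A-SupMin) P orbits {φ′} φ′ε≡ε GR≤A
      α , β , α-aut , β-hom , φ′≈αβ = Equivalence.to (CI A A-SupMin r P orbits φ′) (Q , Q-isSRing , φ-isSRingIso)
  in β , β-hom , connection-sets-related G {S} {A} {r} {P} {T} {φ′} {α} {β}
                   (connection-class G {S} {A} {r} {P} (proj₁ A⪯Aut) orbits) φ′-iso α-aut β-hom φ′≈αβ
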